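{- Let $n\ge3$. The map $\varphi$ defined below is a bijection of $\mathrm{And}_{n-1}^{I}$ onto the set $T_n$ of tight Andr\'e I permutations of $\{1,\dots,n\}$, and for every $w\in\mathrm{And}_{n-1}^{I}$: (i) $\mathbf{spi}\,w=\mathbf{F}\,\varphi(w)$; (ii) $\mathbf{grn}\,\varphi(w)=\mathbf{grn}\,w$ if $\mathbf{spi}\,w>\mathbf{grn}\,w$, and $\mathbf{grn}\,\varphi(w)=\mathbf{grn}\,w+1$ if $\mathbf{spi}\,w<\mathbf{grn}\,w$.
   Context: Andr\'e I permutations: words are permutations of finite sets $Y$ of positive integers; the empty word $e$ and one-letter words are Andr\'e I; for $|Y|\ge2$ write $w=v\,\min(w)\,v'$; $w$ is Andr\'e I if $v,v'$ are Andr\'e I and $\max(vv')$ is a letter of $v'$. $\mathrm{And}_n^{I}$: Andr\'e I permutations of $\{1,\dots,n\}$. For $w=x_1\cdots x_n$: $\mathbf{F}\,w=x_1$; $\mathbf{grn}\,w=\max\{x_{i-1},x_{i+1}\}$ where $x_i$ is the maximum letter, with $x_0=x_{n+1}=0$; $\mathbf{spi}\,w$ is the letter $x_i$ such that $x_1\le x_j$ for all $j\le i$ and $x_1>x_{i+1}$ (convention $x_{n+1}=0$). Tight permutations: $w\in\mathrm{And}_n^{I}$ with $\mathbf{F}\,w=m$ is written $w=m\,v\,(m+1)\,v'$; it is tight if (i) either $v=e$ or all letters of $v$ are less than $m$, and (ii) either $v'\ne e$ and the first letter of $v'$ is less than all letters of $w$ to its left, or $v'=e$ (and then $m=n-1$).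 $T_n$ is the set of tight elements of $\mathrm{And}_n^I$. Definition of $\varphi$: for $w=x_1\cdots x_{n-1}\in\mathrm{And}_{n-1}^I$ let $x_j=\mathbf{spi}\,w$; set $\varphi(w)=x_j\,x'_1x'_2\cdots x'_{n-1}$ where $x'_i=x_i$ if $x_i\le x_j-1$ and $x'_i=x_i+1$ if $x_i\ge x_j$. -}

module Defs where

open import Data.Nat using (ℕ; zero; suc; _⊔_; _<_; _≡ᵇ_; _<ᵇ_; _∸_)
open import Data.Bool using (if_then_else_)
open import Data.List using (List; []; _∷_; _++_; map; upTo; [_])
open import Data.List.Membership.Propositional using (_∈_)
open import Data.List.Relation.Unary.All using (All)
open import Data.List.Relation.Binary.Permutation.Propositional using (_↭_)
open import Data.Product using (Σ; _×_; ∃)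
open import Data.Sum using (_⊎_)
open import Relation.Binary.PropositionalEquality using (_≡_)

-- Words are lists of positive integers.
Word : Set
Word = List ℕ

-- maximum letter (0 for the empty word; letters are positive)
maxL : Word → ℕ
maxL [] = 0
maxL (x ∷ xs) = x ⊔ maxL xs

-- André I words (defined on words with distinct letters, as in the paper):
-- a word of length ≥ 2 is w = v min(w) v', with v, v' André I and
-- max(v v') a letter of v'.
data AndreI : Word → Set where
  empty  : AndreI []
  single : (x : ℕ) → AndreI [ x ]
  node   : (v v' : Word) (m : ℕ) → AndreI v → AndreI v' →
           All (m <_) (v ++ v') →
           maxL (v ++ v') ∈ v' →
           AndreI (v ++ m ∷ v')

IsPerm : ℕ → Word → Set
IsPerm n w = w ↭ map suc (upTo n)

AndI : ℕ → Word → Set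
AndI n w = IsPerm n w × AndreI w

F : Word → ℕ
F [] = 0
F (x ∷ _) = x

head0 : Word → ℕ
head0 [] = 0
head0 (x ∷ _) = x

nbrMax : ℕ → ℕ → Word → ℕ
nbrMax p t [] = 0
nbrMax p t (x ∷ xs) = if x ≡ᵇ t then p ⊔ head0 xs else nbrMax x t xs

-- grn w = max{x_{i-1}, x_{i+1}}, x_i the maximum letter, x_0 = x_{n+1} = 0
grn : Word → ℕ
grn w = nbrMax 0 (maxL w) w

-- spi: with f = x_1, the letter x_i just before the first letter < x_1
-- (x_{n+1} = 0)
spiAux : ℕ → ℕ → Word → ℕ
spiAux f prev [] = prev
spiAux f prev (x ∷ xs) = if x <ᵇ f then prev else spiAux f x xs

spi : Word → ℕ
spi [] = 0
spi (x ∷ xs) = spiAux x x xs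

φ : Word → Word
φ w = s ∷ map (λ x → if x <ᵇ s then x else suc x) w
  where s = spi w

Tight : ℕ → Word → Set
Tight n w = AndI n w ×
  Σ ℕ λ m → Σ Word λ v → Σ Word λ v' →
    (w ≡ m ∷ v ++ suc m ∷ v') ×
    All (_< m) v ×
    ((Σ ℕ λ h → Σ Word λ t → (v' ≡ h ∷ t) × All (h <_) (m ∷ v ++ [ suc m ]))
     ⊎ ((v' ≡ []) × (m ≡ n ∸ 1)))

module Submission where

-- In an André I permutation the maximum is the last letter, and if w = p s q with s = spi w,
-- then the letters of p lie between F w and s while q is empty (s is then the maximum) or
-- starts below F w.  Hence φ w = s p (s+1) q′ is tight, and it is André I because in the
-- relabelled word the letter s+1 occurs before any letter below its first letter, which is
-- what prepending s needs.  The inverse deletes the first letter m and lowers the letters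
-- above m; that spi of the result is m again rests on the fact that a run of letters below the
-- first letter of an André I word begins with its own minimum.  As the maximum is last, grn is
-- the penultimate letter, which φ raises exactly when it is at least spi w.

open import Defs
open import Data.Bool using (true; false; if_then_else_)
open import Data.Empty using (⊥-elim)
open import Data.Unit using (⊤)
open import Data.List using ([]; _∷_; _++_; map; upTo; drop; [_]; _∷ʳ_; initLast; _∷ʳ′_)
open import Data.List.Properties
  using (map-++; ++-assoc; map-injective; map-∘; map-id; map-id-local; map-cong; ∷-injective; upTo-∷ʳ)
open import Data.List.Membership.Propositional using (_∈_)
open import Data.List.Membership.Propositional.Properties
  using (∈-map⁺; ∈-map⁻; ∈-++⁺ˡ; ∈-++⁺ʳ; ∈-upTo⁺; ∈-upTo⁻)
open import Data.List.Relation.Unary.Any using (Any; here; there)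
import Data.List.Relation.Unary.Any.Properties as Any
open import Data.List.Relation.Unary.All as All using (All; []; _∷_)
import Data.List.Relation.Unary.All.Properties as All
open import Data.List.Relation.Unary.AllPairs as AllPairs using ([]; _∷_)
open import Data.List.Relation.Unary.Unique.Propositional using (Unique)
import Data.List.Relation.Unary.Unique.Propositional.Properties as Unique
open import Data.List.Relation.Binary.Permutation.Propositional
  using (_↭_; prep; ↭-sym; ↭-trans; ↭-reflexive; ↭⇒↭ₛ; module PermutationReasoning)
import Data.List.Relation.Binary.Permutation.Propositional.Properties as ↭
import Data.List.Relation.Binary.Permutation.Setoid.Properties as ↭ₛ
open import Data.Nat using (ℕ; zero; suc; _≤_; _<_; _∸_; _<ᵇ_; _≡ᵇ_; z≤n; s≤s; s<s; _<?_)
open import Data.Nat.Properties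
open import Data.Product using (Σ; _×_; _,_; proj₁; proj₂)
open import Data.Sum using (_⊎_; inj₁; inj₂)
open import Function using (_∘_; case_of_)
open import Relation.Binary using (tri<; tri≈; tri>)
open import Relation.Binary.PropositionalEquality
  using (_≡_; _≢_; refl; sym; trans; cong; cong₂; subst; setoid; module ≡-Reasoning)
open import Relation.Nullary using (¬_; yes; no)
open import Relation.Nullary.Reflects using (Reflects; ofʸ; ofⁿ; det; fromEquivalence)

<ᵇ-true : ∀ {m n} → m < n → (m <ᵇ n) ≡ true
<ᵇ-true {m} {n} m<n = det (<ᵇ-reflects-< m n) (ofʸ m<n)

<ᵇ-false : ∀ {m n} → ¬ m < n → (m <ᵇ n) ≡ false
<ᵇ-false {m} {n} m≮n = det (<ᵇ-reflects-< m n) (ofⁿ m≮n)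

≡ᵇ-reflects-≡ : ∀ m n → Reflects (m ≡ n) (m ≡ᵇ n)
≡ᵇ-reflects-≡ m n = fromEquivalence (≡ᵇ⇒≡ m n) (≡⇒≡ᵇ m n)

≡ᵇ-refl : ∀ m → (m ≡ᵇ m) ≡ true
≡ᵇ-refl m = det (≡ᵇ-reflects-≡ m m) (ofʸ refl)

≡ᵇ-false : ∀ {m n} → m ≢ n → (m ≡ᵇ n) ≡ false
≡ᵇ-false {m} {n} m≢n = det (≡ᵇ-reflects-≡ m n) (ofⁿ m≢n)

-- Relabelling letters

shiftUp : ℕ → ℕ → ℕ
shiftUp s x = if x <ᵇ s then x else suc x

shiftDown : ℕ → ℕ → ℕ
shiftDown m x = if m <ᵇ x then x ∸ 1 else x

shiftUp-< : ∀ {s x} → x < s → shiftUp s x ≡ x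
shiftUp-< x<s rewrite <ᵇ-true x<s = refl

shiftUp-≥ : ∀ {s x} → s ≤ x → shiftUp s x ≡ suc x
shiftUp-≥ s≤x rewrite <ᵇ-false (≤⇒≯ s≤x) = refl

shiftUp-strictMono : ∀ s {x y} → x < y → shiftUp s x < shiftUp s y
shiftUp-strictMono s {x} {y} x<y with x <? s | y <? s
... | yes x<s | yes y<s rewrite shiftUp-< x<s | shiftUp-< y<s = x<y
... | yes x<s | no  y≮s rewrite shiftUp-< x<s | shiftUp-≥ (≮⇒≥ y≮s) = m<n⇒m<1+n x<y
... | no  x≮s | yes y<s = ⊥-elim (x≮s (<-trans x<y y<s))
... | no  x≮s | no  y≮s rewrite shiftUp-≥ (≮⇒≥ x≮s) | shiftUp-≥ (≮⇒≥ y≮s) = s<s x<y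

shiftUp-cancel-< : ∀ s {x y} → shiftUp s x < shiftUp s y → x < y
shiftUp-cancel-< s {x} {y} fx<fy with <-cmp x y
... | tri< x<y _ _ = x<y
... | tri≈ _ refl _ = ⊥-elim (<-irrefl refl fx<fy)
... | tri> _ _ y<x = ⊥-elim (<-asym fx<fy (shiftUp-strictMono s y<x))

shiftUp-injective : ∀ s {x y} → shiftUp s x ≡ shiftUp s y → x ≡ y
shiftUp-injective s {x} {y} fx≡fy with <-cmp x y
... | tri< x<y _ _ = ⊥-elim (<⇒≢ (shiftUp-strictMono s x<y) fx≡fy)
... | tri≈ _ x≡y _ = x≡y
... | tri> _ _ y<x = ⊥-elim (<⇒≢ (shiftUp-strictMono s y<x) (sym fx≡fy))

shiftUp-≢ : ∀ s x → shiftUp s x ≢ s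
shiftUp-≢ s x with x <? s
... | yes x<s rewrite shiftUp-< x<s = <⇒≢ x<s
... | no  x≮s rewrite shiftUp-≥ (≮⇒≥ x≮s) = x≮s ∘ ≤-reflexive

shiftDown-≤ : ∀ {m x} → x ≤ m → shiftDown m x ≡ x
shiftDown-≤ x≤m rewrite <ᵇ-false (≤⇒≯ x≤m) = refl

shiftDown-suc : ∀ {m x} → m ≤ x → shiftDown m (suc x) ≡ x
shiftDown-suc m≤x rewrite <ᵇ-true (s≤s m≤x) = refl

shiftDown-shiftUp : ∀ m x → shiftDown m (shiftUp m x) ≡ x
shiftDown-shiftUp m x with x <? m
... | yes x<m rewrite shiftUp-< x<m = shiftDown-≤ (<⇒≤ x<m)
... | no  x≮m rewrite shiftUp-≥ (≮⇒≥ x≮m) = shiftDown-suc (≮⇒≥ x≮m)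

shiftUp-shiftDown : ∀ m x → x ≢ m → shiftUp m (shiftDown m x) ≡ x
shiftUp-shiftDown m x x≢m with <-cmp x m
... | tri< x<m _ _ rewrite shiftDown-≤ (<⇒≤ x<m) = shiftUp-< x<m
... | tri≈ _ x≡m _ = ⊥-elim (x≢m x≡m)
shiftUp-shiftDown m (suc x) _ | tri> _ _ m<x rewrite shiftDown-suc (≤-pred m<x) = shiftUp-≥ (≤-pred m<x)

shiftDown-strictMono : ∀ m {x y} → x ≢ m → y ≢ m → x < y → shiftDown m x < shiftDown m y
shiftDown-strictMono m {x} {y} x≢m y≢m x<y = shiftUp-cancel-< m (begin-strict
  shiftUp m (shiftDown m x) ≡⟨ shiftUp-shiftDown m x x≢m ⟩
  x                         <⟨ x<y ⟩
  y                         ≡⟨ shiftUp-shiftDown m y y≢m ⟨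
  shiftUp m (shiftDown m y) ∎)
  where open ≤-Reasoning

range : ℕ → Word
range k = map suc (upTo k)

∈-range⁻ : ∀ {x k} → x ∈ range k → 1 ≤ x × x ≤ k
∈-range⁻ x∈ with ∈-map⁻ suc x∈
... | y , y∈ , refl = s≤s z≤n , ∈-upTo⁻ y∈

∈-range⁺ : ∀ {x k} → 1 ≤ x → x ≤ k → x ∈ range k
∈-range⁺ {suc y} _ y<k = ∈-map⁺ suc (∈-upTo⁺ y<k)

range-unique : ∀ k → Unique (range k)
range-unique k = Unique.map⁺ suc-injective (Unique.upTo⁺ k)

range-suc : ∀ k → range (suc k) ≡ range k ∷ʳ suc k
range-suc k = trans (cong (map suc) (sym (upTo-∷ʳ k))) (map-++ suc (upTo k) [ k ])

shiftUp-range : ∀ k s → 1 ≤ s → s ≤ k → s ∷ map (shiftUp s) (range k) ↭ range (suc k)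
shiftUp-range zero s 1≤s s≤0 = ⊥-elim (<⇒≱ 1≤s s≤0)
shiftUp-range (suc k) s 1≤s s≤1+k = begin
  s ∷ map f (range (suc k))          ≡⟨ cong (s ∷_) last-shifted ⟩
  s ∷ map f (range k) ∷ʳ suc (suc k) ↭⟨ ↭.++⁺ʳ [ suc (suc k) ] (init (m≤n⇒m<n∨m≡n s≤1+k)) ⟩
  range (suc k) ∷ʳ suc (suc k)       ≡⟨ range-suc (suc k) ⟨
  range (suc (suc k))                ∎
  where
  open PermutationReasoning
  f = shiftUp s
  last-shifted : map f (range (suc k)) ≡ map f (range k) ∷ʳ suc (suc k)
  last-shifted = trans (cong (map f) (range-suc k))
    (trans (map-++ f (range k) [ suc k ]) (cong (map f (range k) ∷ʳ_) (shiftUp-≥ s≤1+k)))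
  init : s < suc k ⊎ s ≡ suc k → s ∷ map f (range k) ↭ range (suc k)
  init (inj₁ s<1+k) = shiftUp-range k s 1≤s (≤-pred s<1+k)
  init (inj₂ refl)  = begin
    s ∷ map f (range k) ≡⟨ cong (s ∷_) (map-id-local (All.tabulate (shiftUp-< ∘ s≤s ∘ proj₂ ∘ ∈-range⁻))) ⟩
    s ∷ range k         ↭⟨ ↭.∷↭∷ʳ s (range k) ⟩
    range k ∷ʳ s        ≡⟨ range-suc k ⟨
    range s             ∎

-- Maximum letter and distinct letters

maxL-upperBound : ∀ u → All (_≤ maxL u) u
maxL-upperBound []       = []
maxL-upperBound (x ∷ xs) =
  m≤m⊔n x (maxL xs) ∷ All.map (λ y≤ → ≤-trans y≤ (m≤n⊔m x (maxL xs))) (maxL-upperBound xs)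

maxL-least : ∀ u {M} → All (_≤ M) u → maxL u ≤ M
maxL-least []       _          = z≤n
maxL-least (x ∷ xs) (x≤ ∷ xs≤) = ⊔-lub x≤ (maxL-least xs xs≤)

maxL-∈-∷ : ∀ x xs → maxL (x ∷ xs) ∈ x ∷ xs
maxL-∈-∷ x []       = here (⊔-identityʳ x)
maxL-∈-∷ x (y ∷ ys) with ⊔-sel x (maxL (y ∷ ys))
... | inj₁ x⊔≡x = here x⊔≡x
... | inj₂ x⊔≡m = there (subst (_∈ y ∷ ys) (sym x⊔≡m) (maxL-∈-∷ y ys))

maxL-∈ : ∀ {u : Word} {y} → y ∈ u → maxL u ∈ u
maxL-∈ {x ∷ xs} _ = maxL-∈-∷ x xs

maxL-≡ : ∀ {u M} → M ∈ u → All (_≤ M) u → maxL u ≡ M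
maxL-≡ {u} M∈u u≤M = ≤-antisym (maxL-least u u≤M) (All.lookup (maxL-upperBound u) M∈u)

<-maxL : ∀ {s u} → Any (s <_) u → s < maxL u
<-maxL {u = x ∷ xs} (here  s<x)  = <-≤-trans s<x (m≤m⊔n x (maxL xs))
<-maxL {u = x ∷ xs} (there s<xs) = <-≤-trans (<-maxL s<xs) (m≤n⊔m x (maxL xs))

maxL-∷-< : ∀ {s u} → Any (s <_) u → maxL (s ∷ u) ≡ maxL u
maxL-∷-< s<u = m≤n⇒m⊔n≡n (<⇒≤ (<-maxL s<u))

maxL-↭-range : ∀ {w k} → w ↭ range (suc k) → maxL w ≡ suc k
maxL-↭-range w↭ = maxL-≡ (↭.∈-resp-↭ (↭-sym w↭) (∈-range⁺ (s≤s z≤n) ≤-refl))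
                         (All.tabulate (proj₂ ∘ ∈-range⁻ ∘ ↭.∈-resp-↭ w↭))

StrictMonoOn : (ℕ → Set) → (ℕ → ℕ) → Set
StrictMonoOn P g = ∀ {x y} → P x → P y → x < y → g x < g y

maxL-map : ∀ {P g} → StrictMonoOn P g → ∀ {u y} → y ∈ u → All P u →
           maxL (map g u) ≡ g (maxL u)
maxL-map {P} {g} mono {u} y∈u Pu = maxL-≡ (∈-map⁺ g max∈u) (All.map⁺ (All.tabulate g≤))
  where
  max∈u = maxL-∈ y∈u
  g≤ : ∀ {z} → z ∈ u → g z ≤ g (maxL u)
  g≤ z∈u with m≤n⇒m<n∨m≡n (All.lookup (maxL-upperBound u) z∈u)
  ... | inj₁ z<max = <⇒≤ (mono (All.lookup Pu z∈u) (All.lookup Pu max∈u) z<max)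
  ... | inj₂ z≡max = ≤-reflexive (cong g z≡max)

Unique-resp-↭ : ∀ {xs ys : Word} → xs ↭ ys → Unique xs → Unique ys
Unique-resp-↭ xs↭ys = ↭ₛ.Unique-resp-↭ (setoid ℕ) (↭⇒↭ₛ xs↭ys)

Unique-++⁻ˡ : ∀ (a : Word) {b} → Unique (a ++ b) → Unique a
Unique-++⁻ˡ []      _           = []
Unique-++⁻ˡ (x ∷ a) (x∉ ∷ uniq) = All.++⁻ˡ a x∉ ∷ Unique-++⁻ˡ a uniq

Unique-++⁻ʳ : ∀ (a : Word) {b} → Unique (a ++ b) → Unique b
Unique-++⁻ʳ []      uniq       = uniq
Unique-++⁻ʳ (x ∷ a) (_ ∷ uniq) = Unique-++⁻ʳ a uniq

Unique-++-disjoint : ∀ (a : Word) {b x y} → Unique (a ++ b) → x ∈ a → y ∈ b → x ≢ y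
Unique-++-disjoint (z ∷ a) (z∉ ∷ _)    (here refl) y∈b = All.lookup z∉ (∈-++⁺ʳ a y∈b)
Unique-++-disjoint (z ∷ a) (_  ∷ uniq) (there x∈a) y∈b = Unique-++-disjoint a uniq x∈a y∈b

AndI-unique : ∀ {n w} → AndI n w → Unique w
AndI-unique (w↭ , _) = Unique-resp-↭ (↭-sym w↭) (range-unique _)

-- André I words

EndsWithMax : Word → Set
EndsWithMax u = Σ Word λ a → Σ ℕ λ M → u ≡ a ∷ʳ M × All (_< M) a

AndreI-endsWithMax : ∀ {u} → AndreI u → Unique u → u ≡ [] ⊎ EndsWithMax u
AndreI-endsWithMax empty      _ = inj₁ refl
AndreI-endsWithMax (single x) _ = inj₂ ([] , x , refl , [])
AndreI-endsWithMax (node v v' m _ av' m< max∈v') uniq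
  with AndreI-endsWithMax av' (AllPairs.tail (Unique-++⁻ʳ v uniq))
... | inj₁ refl = case max∈v' of λ ()
... | inj₂ (a , M , refl , a<M) =
  inj₂ (v ++ m ∷ a , M , sym (++-assoc v (m ∷ a) [ M ]) , All.++⁺ v<M (m<M ∷ a<M))
  where
  M∈v' : M ∈ a ∷ʳ M
  M∈v' = ∈-++⁺ʳ a (here refl)
  m<M : m < M
  m<M = All.lookup m< (∈-++⁺ʳ v M∈v')
  max≤M : maxL (v ++ a ∷ʳ M) ≤ M
  max≤M = All.lookup (All.++⁺ (All.map <⇒≤ a<M) (≤-refl ∷ [])) max∈v'
  v<M : All (_< M) v
  v<M = All.tabulate λ y∈v →
    ≤∧≢⇒< (≤-trans (All.lookup (maxL-upperBound (v ++ a ∷ʳ M)) (∈-++⁺ˡ y∈v)) max≤M)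
          (Unique-++-disjoint v uniq y∈v (there M∈v'))

AndreI-head-not-max : ∀ {x xs} → AndreI (x ∷ xs) → Unique (x ∷ xs) → xs ≡ [] ⊎ Any (x <_) xs
AndreI-head-not-max ax uniq with AndreI-endsWithMax ax uniq
... | inj₂ ([]    , M , refl , _)   = inj₁ refl
... | inj₂ (_ ∷ a , M , refl , a<M) = inj₂ (Any.++⁺ʳ a (here (All.head a<M)))

AndreI-tail : ∀ {u} → AndreI u → AndreI (drop 1 u)
AndreI-tail empty                          = empty
AndreI-tail (single x)                     = empty
AndreI-tail (node []       v' m _  av' _ _) = av'
AndreI-tail (node (x ∷ v₁) v' m av av' m< max∈v') =
  node v₁ v' m (AndreI-tail av) av' (All.tail m<) (subst (_∈ v') (sym max≡) max∈v')
  where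
  max≡ : maxL (v₁ ++ v') ≡ maxL (x ∷ v₁ ++ v')
  max≡ = maxL-≡ (∈-++⁺ʳ v₁ max∈v') (All.tail (maxL-upperBound (x ∷ v₁ ++ v')))

AndreI-map : ∀ {P g} → StrictMonoOn P g → ∀ {u} → AndreI u → All P u → AndreI (map g u)
AndreI-map mono empty      _  = empty
AndreI-map mono (single x) _  = single _
AndreI-map {P} {g} mono (node v v' m av av' m< max∈v') Pu =
  subst AndreI (sym (map-++ g v (m ∷ v')))
    (node (map g v) (map g v') (g m) (AndreI-map mono av Pv) (AndreI-map mono av' Pv') gm< gmax∈)
  where
  Pv = All.++⁻ˡ v Pu
  Pm = All.head (All.++⁻ʳ v Pu)
  Pv' = All.tail (All.++⁻ʳ v Pu)
  Pvv' = All.++⁺ Pv Pv'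
  gm< : All (g m <_) (map g v ++ map g v')
  gm< = subst (All (g m <_)) (map-++ g v v')
          (All.map⁺ (All.zipWith (λ (m<y , Py) → mono Pm Py m<y) (m< , Pvv')))
  max≡ : g (maxL (v ++ v')) ≡ maxL (map g v ++ map g v')
  max≡ = trans (sym (maxL-map mono (∈-++⁺ʳ v max∈v') Pvv')) (cong maxL (map-++ g v v'))
  gmax∈ : maxL (map g v ++ map g v') ∈ map g v'
  gmax∈ = subst (_∈ map g v') max≡ (∈-map⁺ g max∈v')

data RisesAbove (s h : ℕ) : Word → Set where
  rise : ∀ {x xs} → s < x → RisesAbove s h (x ∷ xs)
  stay : ∀ {x xs} → h ≤ x → x < s → RisesAbove s h xs → RisesAbove s h (x ∷ xs)

RisesAbove⇒Any : ∀ {s h u} → RisesAbove s h u → Any (s <_) u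
RisesAbove⇒Any (rise s<x)   = here s<x
RisesAbove⇒Any (stay _ _ r) = there (RisesAbove⇒Any r)

RisesAbove-++ : ∀ {s h} (p : Word) {x r} → All (λ y → h ≤ y × y < s) p → s < x →
                RisesAbove s h (p ++ x ∷ r)
RisesAbove-++ []      _                   s<x = rise s<x
RisesAbove-++ (y ∷ p) ((h≤y , y<s) ∷ ps) s<x = stay h≤y y<s (RisesAbove-++ p ps s<x)

RisesAbove-++⁻ˡ : ∀ {s h} (a : Word) {m b} → m < h → m < s →
                  RisesAbove s h (a ++ m ∷ b) → RisesAbove s h a
RisesAbove-++⁻ˡ []      m<h m<s (rise s<m)       = ⊥-elim (<-asym s<m m<s)
RisesAbove-++⁻ˡ []      m<h m<s (stay h≤m _ _)   = ⊥-elim (<⇒≱ m<h h≤m)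
RisesAbove-++⁻ˡ (x ∷ a) m<h m<s (rise s<x)       = rise s<x
RisesAbove-++⁻ˡ (x ∷ a) m<h m<s (stay h≤x x<s r) = stay h≤x x<s (RisesAbove-++⁻ˡ a m<h m<s r)

-- For s > min u, s joins the left factor v of u = v min(u) v′.  RisesAbove provides a letter
-- above s, so the maximum of the factors is unchanged; since min u < F u, that letter lies in v
-- when v is nonempty, which is what the recursion into v needs.
AndreI-cons : ∀ {s u} → AndreI u → All (_≢ s) u → RisesAbove s (F u) u → AndreI (s ∷ u)
AndreI-cons (single x) _ (rise s<x) =
  node [] [ x ] _ empty (single x) (s<x ∷ []) (here (⊔-identityʳ x))
AndreI-cons {s} au@(node v v' m _ _ m< _) ≢s r with <-cmp s m
... | tri< s<m _ _ = node [] (v ++ m ∷ v') s empty au s<u (maxL-∈ (∈-++⁺ʳ v (here refl)))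
  where
  s<u : All (s <_) (v ++ m ∷ v')
  s<u = All.++⁺ (All.map (<-trans s<m) (All.++⁻ˡ v m<)) (s<m ∷ All.map (<-trans s<m) (All.++⁻ʳ v m<))
... | tri≈ _ refl _ = ⊥-elim (All.lookup ≢s (∈-++⁺ʳ v (here refl)) refl)
AndreI-cons (node [] v' m _ _ _ _) _ (rise s<m) | tri> _ _ m<s = ⊥-elim (<-asym s<m m<s)
AndreI-cons {s} (node [] v' m _ av' m< max∈v') _ (stay _ _ r) | tri> _ _ m<s =
  node [ s ] v' m (single s) av' (m<s ∷ m<)
       (subst (_∈ v') (sym (maxL-∷-< (RisesAbove⇒Any r))) max∈v')
AndreI-cons {s} (node (y ∷ v₁) v' m av av' m< max∈v') ≢s r | tri> _ _ m<s =
  node (s ∷ y ∷ v₁) v' m (AndreI-cons av (All.++⁻ˡ (y ∷ v₁) ≢s) rv) av' (m<s ∷ m<)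
       (subst (_∈ v') (sym (maxL-∷-< (Any.++⁺ˡ (RisesAbove⇒Any rv)))) max∈v')
  where
  rv : RisesAbove s y (y ∷ v₁)
  rv = RisesAbove-++⁻ˡ (y ∷ v₁) (All.head m<) m<s r

++-∷-≡-++ : ∀ (a b c : Word) m d → a ++ m ∷ d ≡ b ++ c →
  (Σ Word λ e → a ≡ b ++ e × c ≡ e ++ m ∷ d) ⊎ (Σ Word λ e → b ≡ a ++ m ∷ e × d ≡ e ++ c)
++-∷-≡-++ a       []      c m d eq = inj₁ (a , refl , sym eq)
++-∷-≡-++ []      (y ∷ b) c m d eq with ∷-injective eq
... | refl , d≡ = inj₂ (b , refl , d≡)
++-∷-≡-++ (x ∷ a) (y ∷ b) c m d eq with ∷-injective eq
... | refl , eq′ with ++-∷-≡-++ a b c m d eq′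
...   | inj₁ (e , a≡ , c≡) = inj₁ (e , cong (x ∷_) a≡ , c≡)
...   | inj₂ (e , b≡ , d≡) = inj₂ (e , cong (x ∷_) b≡ , d≡)

-- Write u = v min(u) v′ with v = s v₁.  Either p is a prefix of v₁ and induction applies to v,
-- or p = v₁ min(u) …; then v₁ is empty because the first letter of v is not its maximum, so p
-- starts with min(u).
AndreI-lowRun-headMin : ∀ {u} → AndreI u → Unique u → ∀ s (p q : Word) →
  u ≡ s ∷ p ++ q → All (_< s) p → All (F p ≤_) p
AndreI-lowRun-headMin _ _ s [] q _ _ = []
AndreI-lowRun-headMin (node [] v' m _ _ m< _) _ s (y ∷ p) q eq (y<s ∷ _) with ∷-injective eq
... | refl , v'≡ = ⊥-elim (<-asym y<s (All.lookup m< (subst (y ∈_) (sym v'≡) (here refl))))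
AndreI-lowRun-headMin (node (z ∷ v₁) v' m av _ m< _) uniq s (y ∷ p) q eq p<s with ∷-injective eq
... | refl , eq′ with ++-∷-≡-++ v₁ (y ∷ p) q m v' eq′
...   | inj₁ (e , refl , _) =
  AndreI-lowRun-headMin av (Unique-++⁻ˡ (z ∷ v₁) uniq) z (y ∷ p) e refl p<s
...   | inj₂ (e , p≡ , v'≡) with v₁
...     | [] with refl , refl ← ∷-injective p≡ =
  ≤-refl ∷ All.map <⇒≤ (All.++⁻ˡ e (subst (All (m <_)) v'≡ (All.tail m<)))
...     | w ∷ ws with AndreI-head-not-max av (Unique-++⁻ˡ (z ∷ w ∷ ws) uniq)
...       | inj₂ z<v₁ =
  ⊥-elim (All.All¬⇒¬Any (All.map <⇒≯ (All.++⁻ˡ (w ∷ ws) (subst (All (_< z)) p≡ p<s))) z<v₁)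

-- The statistic spi

data StartsBelow (b : ℕ) : Word → Set where
  startsBelow : ∀ {h t} → h < b → StartsBelow b (h ∷ t)

spiAux-≥ : ∀ f prev (a : Word) x q → All (f ≤_) a → f ≤ x →
           spiAux f prev (a ++ x ∷ q) ≡ spiAux f x q
spiAux-≥ f prev []      x q []           f≤x rewrite <ᵇ-false (≤⇒≯ f≤x) = refl
spiAux-≥ f prev (y ∷ a) x q (f≤y ∷ f≤a) f≤x rewrite <ᵇ-false (≤⇒≯ f≤y) =
  spiAux-≥ f y a x q f≤a f≤x

spiAux-< : ∀ f prev (a : Word) h t → h < f → spiAux f prev (a ++ h ∷ t) ≡ spiAux f prev a
spiAux-< f prev []      h t h<f rewrite <ᵇ-true h<f = refl
spiAux-< f prev (y ∷ a) h t h<f with y <ᵇ f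
... | true  = refl
... | false = spiAux-< f y a h t h<f

spiAux-end : ∀ f prev {q} → q ≡ [] ⊎ StartsBelow f q → spiAux f prev q ≡ prev
spiAux-end f prev (inj₁ refl)                = refl
spiAux-end f prev (inj₂ (startsBelow h<f)) rewrite <ᵇ-true h<f = refl

spiAux-∈ : ∀ f prev xs → spiAux f prev xs ∈ prev ∷ xs
spiAux-∈ f prev []       = here refl
spiAux-∈ f prev (x ∷ xs) with x <ᵇ f
... | true  = here refl
... | false = there (spiAux-∈ f x xs)

spi-∈ : ∀ {u : Word} {y} → y ∈ u → spi u ∈ u
spi-∈ {x ∷ xs} _ = spiAux-∈ x x xs

spi-≡ : ∀ (p : Word) s q → let f = F (p ++ s ∷ q) in
  All (f ≤_) p → f ≤ s → q ≡ [] ⊎ StartsBelow f q → spi (p ++ s ∷ q) ≡ s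
spi-≡ []      s q _         _   q-end = spiAux-end s s q-end
spi-≡ (y ∷ p) s q (_ ∷ y≤p) y≤s q-end =
  trans (spiAux-≥ y y p s q y≤p y≤s) (spiAux-end y s q-end)

SpiTail : Word → ℕ → Word → Set
SpiTail w s q = (q ≡ [] × s ≡ maxL w) ⊎ StartsBelow (F w) q

data SpiSplit (w : Word) (s : ℕ) : Set where
  spiSplit : ∀ p q → w ≡ p ++ s ∷ q → All (λ y → F w ≤ y × y < s) p → F w ≤ s →
             SpiTail w s q → SpiSplit w s

AndreI-spiSplit : ∀ {w} → AndreI w → Unique w → w ≡ [] ⊎ SpiSplit w (spi w)
AndreI-spiSplit empty      _ = inj₁ refl
AndreI-spiSplit (single x) _ =
  inj₂ (spiSplit [] [] refl [] ≤-refl (inj₁ (refl , sym (⊔-identityʳ x))))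
AndreI-spiSplit (node [] v' m _ av' m< max∈v') uniq with AndreI-endsWithMax av' (AllPairs.tail uniq)
... | inj₁ refl = case max∈v' of λ ()
... | inj₂ (a , M , refl , a<M) = inj₂ (subst (SpiSplit (m ∷ a ∷ʳ M)) (sym spi≡M) split)
  where
  m<a = All.++⁻ˡ a m<
  m<M = All.lookup m< (∈-++⁺ʳ a (here refl))
  spi≡M : spiAux m m (a ∷ʳ M) ≡ M
  spi≡M = spiAux-≥ m m a M [] (All.map <⇒≤ m<a) (<⇒≤ m<M)
  max≡M : M ≡ maxL (m ∷ a ∷ʳ M)
  max≡M = sym (maxL-≡ (there (∈-++⁺ʳ a (here refl)))
                      (<⇒≤ m<M ∷ All.++⁺ (All.map <⇒≤ a<M) (≤-refl ∷ [])))
  p∈ : All (λ y → m ≤ y × y < M) (m ∷ a)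
  p∈ = (≤-refl , m<M) ∷ All.zipWith (λ (m<y , y<M) → <⇒≤ m<y , y<M) (m<a , a<M)
  split : SpiSplit (m ∷ a ∷ʳ M) M
  split = spiSplit (m ∷ a) [] refl p∈ (<⇒≤ m<M) (inj₁ (refl , max≡M))
AndreI-spiSplit (node (x ∷ v₁) v' m av _ m< _) uniq with AndreI-spiSplit av (Unique-++⁻ˡ (x ∷ v₁) uniq)
... | inj₂ (spiSplit p q v≡ p∈ x≤s q-end) =
  inj₂ (subst (SpiSplit (x ∷ v₁ ++ m ∷ v')) (sym spi≡)
              (spiSplit p (q ++ m ∷ v') w≡ p∈ x≤s (inj₂ (tail-below q-end))))
  where
  m<x = All.head m<
  spi≡ : spiAux x x (v₁ ++ m ∷ v') ≡ spiAux x x v₁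
  spi≡ = spiAux-< x x v₁ m v' m<x
  w≡ : x ∷ v₁ ++ m ∷ v' ≡ p ++ spiAux x x v₁ ∷ q ++ m ∷ v'
  w≡ = trans (cong (_++ m ∷ v') v≡) (++-assoc p (spiAux x x v₁ ∷ q) (m ∷ v'))
  tail-below : ∀ {q} → SpiTail (x ∷ v₁) (spiAux x x v₁) q → StartsBelow x (q ++ m ∷ v')
  tail-below (inj₁ (refl , _))        = startsBelow m<x
  tail-below (inj₂ (startsBelow h<x)) = startsBelow h<x

-- The bijection φ onto tight permutations

TightTail : ℕ → ℕ → Word → Word → Set
TightTail n m v v' =
  (Σ ℕ λ h → Σ Word λ t → v' ≡ h ∷ t × All (h <_) (m ∷ v ++ [ suc m ])) ⊎ (v' ≡ [] × m ≡ n ∸ 1)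

map-shiftUp-split : ∀ s (p q : Word) → All (_< s) p →
                    map (shiftUp s) (p ++ s ∷ q) ≡ p ++ suc s ∷ map (shiftUp s) q
map-shiftUp-split s p q p<s = trans (map-++ (shiftUp s) p (s ∷ q))
  (cong₂ _++_ (map-id-local (All.map shiftUp-< p<s))
              (cong (_∷ map (shiftUp s) q) (shiftUp-≥ ≤-refl)))

SpiSplit⇒tight : ∀ {k w s} → AndI (suc k) w → SpiSplit w s →
                 Tight (suc (suc k)) (s ∷ map (shiftUp s) w)
SpiSplit⇒tight {k} {s = s} (w↭ , aw) (spiSplit p q refl p∈ F≤s q-end) =
  (perm , andre) , s , p , map f q , cong (s ∷_) shifted , All.map proj₂ p∈ , tight-tail q-end
  where
  f = shiftUp s
  w = p ++ s ∷ q
  shifted = map-shiftUp-split s p q (All.map proj₂ p∈)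
  s-range = ∈-range⁻ (↭.∈-resp-↭ w↭ (∈-++⁺ʳ p (here refl)))
  perm : s ∷ map f w ↭ range (suc (suc k))
  perm = ↭-trans (prep s (↭.map⁺ f w↭)) (shiftUp-range (suc k) s (proj₁ s-range) (proj₂ s-range))
  rises : ∀ p′ → All (λ y → F (p′ ++ s ∷ q) ≤ y × y < s) p′ →
          RisesAbove s (F (p′ ++ suc s ∷ map f q)) (p′ ++ suc s ∷ map f q)
  rises []       _  = rise (n<1+n s)
  rises (y ∷ p′) p∈ = RisesAbove-++ (y ∷ p′) p∈ (n<1+n s)
  andre : AndreI (s ∷ map f w)
  andre = AndreI-cons (AndreI-map {P = λ _ → ⊤} (λ _ _ → shiftUp-strictMono s) aw (All.tabulate _))
                      (All.map⁺ (All.tabulate λ {x} _ → shiftUp-≢ s x))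
                      (subst (λ u → RisesAbove s (F u) u) (sym shifted) (rises p p∈))
  tight-tail : SpiTail w s q → TightTail (suc (suc k)) s p (map f q)
  tight-tail (inj₁ (refl , s≡max)) = inj₂ (refl , trans s≡max (maxL-↭-range w↭))
  tight-tail (inj₂ (startsBelow {h} {t} h<F)) =
    inj₁ (h , map f t , cong (_∷ map f t) (shiftUp-< h<s) ,
          h<s ∷ All.++⁺ (All.map (λ (F≤y , _) → <-≤-trans h<F F≤y) p∈) (m<n⇒m<1+n h<s ∷ []))
    where h<s = <-≤-trans h<F F≤s

φ-tight : ∀ {k w} → AndI (suc k) w → Tight (suc (suc k)) (φ w)
φ-tight w∈@(w↭ , aw) with AndreI-spiSplit aw (AndI-unique w∈)
... | inj₁ refl  = case ↭.↭-length w↭ of λ ()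
... | inj₂ split = SpiSplit⇒tight w∈ split

φ-injective : ∀ {w w'} → φ w ≡ φ w' → w ≡ w'
φ-injective {w} {w'} φ≡ with ∷-injective φ≡
... | spi≡ , shifted≡ = map-injective (shiftUp-injective (spi w'))
  (subst (λ s → map (shiftUp s) w ≡ map (shiftUp (spi w')) w') spi≡ shifted≡)

map-shiftDown-shiftUp : ∀ m (xs : Word) → map (shiftDown m) (map (shiftUp m) xs) ≡ xs
map-shiftDown-shiftUp m xs =
  trans (sym (map-∘ xs)) (trans (map-cong (shiftDown-shiftUp m) xs) (map-id xs))

map-shiftUp-shiftDown : ∀ m {xs : Word} → All (_≢ m) xs → map (shiftUp m) (map (shiftDown m) xs) ≡ xs
map-shiftUp-shiftDown m {xs} xs≢m =
  trans (sym (map-∘ xs)) (map-id-local (All.map (shiftUp-shiftDown m _) xs≢m))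

TightTail-shiftDown : ∀ {n m v v' b} → b ∈ m ∷ v → TightTail n m v v' →
  map (shiftDown m) v' ≡ [] ⊎ StartsBelow b (map (shiftDown m) v')
TightTail-shiftDown _  (inj₂ (refl , _)) = inj₁ refl
TightTail-shiftDown {b = b} b∈ (inj₁ (h , t , refl , h<)) =
  inj₂ (startsBelow (subst (_< b) (sym (shiftDown-≤ (<⇒≤ (All.head h<))))
                               (All.lookup h< (∈-++⁺ˡ b∈))))

spi-shiftDown : ∀ {n} m (v v' : Word) → All (_< m) v → All (F v ≤_) v → TightTail n m v v' →
  spi (v ++ m ∷ map (shiftDown m) v') ≡ m
spi-shiftDown {n} m []      v' _         _         tail =
  spi-≡ [] m _ [] ≤-refl (TightTail-shiftDown {n} {v = []} (here refl) tail)
spi-shiftDown {n} m (y ∷ v) v' (y<m ∷ _) (_ ∷ y≤v) tail =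
  spi-≡ (y ∷ v) m _ (≤-refl ∷ y≤v) (<⇒≤ y<m)
        (TightTail-shiftDown {n} {v = y ∷ v} (there (here refl)) tail)

φ-surjective : ∀ {N u} → Tight (suc N) u → Σ Word λ w → AndI N w × φ w ≡ u
φ-surjective {N} ((u↭ , au) , m , v , v' , refl , v<m , tail) = w , (w↭ , aw) , φw≡u
  where
  rest = v ++ suc m ∷ v'
  w = map (shiftDown m) rest
  uniq = AndI-unique (u↭ , au)
  rest≢m : All (_≢ m) rest
  rest≢m = All.map (λ m≢y y≡m → m≢y (sym y≡m)) (AllPairs.head uniq)
  m-range = ∈-range⁻ (↭.∈-resp-↭ u↭ (here refl))
  m≤N : m ≤ N
  m≤N = ≤-pred (proj₂ (∈-range⁻ (↭.∈-resp-↭ u↭ (there (∈-++⁺ʳ v (here refl))))))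
  rest↭ : rest ↭ map (shiftUp m) (range N)
  rest↭ = ↭.drop-∷ (↭-trans u↭ (↭-sym (shiftUp-range N m (proj₁ m-range) m≤N)))
  w↭ : w ↭ range N
  w↭ = ↭-trans (↭.map⁺ (shiftDown m) rest↭) (↭-reflexive (map-shiftDown-shiftUp m (range N)))
  aw : AndreI w
  aw = AndreI-map (shiftDown-strictMono m) (AndreI-tail au) rest≢m
  w≡ : w ≡ v ++ m ∷ map (shiftDown m) v'
  w≡ = trans (map-++ (shiftDown m) v (suc m ∷ v'))
             (cong₂ _++_ (map-id-local (All.map (shiftDown-≤ ∘ <⇒≤) v<m))
                         (cong (_∷ map (shiftDown m) v') (shiftDown-suc ≤-refl)))
  spi≡m : spi w ≡ m
  spi≡m = trans (cong spi w≡)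
    (spi-shiftDown {suc N} m v v' v<m (AndreI-lowRun-headMin au uniq m v (suc m ∷ v') refl v<m) tail)
  φw≡u : φ w ≡ m ∷ rest
  φw≡u = cong₂ _∷_ spi≡m
    (trans (cong (λ s → map (shiftUp s) w) spi≡m) (map-shiftUp-shiftDown m rest≢m))

-- The statistic grn

nbrMax-∷ʳ : ∀ p t (b : Word) x → All (_≢ t) b → x ≢ t → nbrMax p t (b ∷ʳ x ∷ʳ t) ≡ x
nbrMax-∷ʳ p t []      x _           x≢t rewrite ≡ᵇ-false x≢t | ≡ᵇ-refl t = ⊔-identityʳ x
nbrMax-∷ʳ p t (y ∷ b) x (y≢t ∷ b≢t) x≢t rewrite ≡ᵇ-false y≢t = nbrMax-∷ʳ y t b x b≢t x≢t

grn-∷ʳ-max : ∀ (b : Word) x M → All (_< M) (b ∷ʳ x) → grn (b ∷ʳ x ∷ʳ M) ≡ x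
grn-∷ʳ-max b x M bx<M = trans (cong (λ t → nbrMax 0 t (b ∷ʳ x ∷ʳ M)) max≡M)
  (nbrMax-∷ʳ 0 M b x (All.map <⇒≢ (All.++⁻ˡ b bx<M)) (<⇒≢ (All.head (All.++⁻ʳ b bx<M))))
  where
  max≡M : maxL (b ∷ʳ x ∷ʳ M) ≡ M
  max≡M = maxL-≡ (∈-++⁺ʳ (b ∷ʳ x) (here refl)) (All.++⁺ (All.map <⇒≤ bx<M) (≤-refl ∷ []))

grn-φ : ∀ {k w} → AndI (suc (suc k)) w → grn (φ w) ≡ shiftUp (spi w) (grn w)
grn-φ w∈@(w↭ , aw) with AndreI-endsWithMax aw (AndI-unique w∈)
... | inj₁ refl = case ↭.↭-length w↭ of λ ()
... | inj₂ (a , M , refl , a<M) with initLast a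
...   | []       = case ↭.↭-length w↭ of λ ()
...   | b ∷ʳ′ x = begin
  grn (φ w)                         ≡⟨ cong grn φw≡ ⟩
  grn ((s ∷ map f b) ∷ʳ f x ∷ʳ f M) ≡⟨ grn-∷ʳ-max (s ∷ map f b) (f x) (f M) sbx<fM ⟩
  f x                               ≡⟨ cong f (grn-∷ʳ-max b x M a<M) ⟨
  f (grn w)                         ∎
  where
  open ≡-Reasoning
  w = b ∷ʳ x ∷ʳ M
  s = spi w
  f = shiftUp s
  φw≡ : φ w ≡ (s ∷ map f b) ∷ʳ f x ∷ʳ f M
  φw≡ = cong (s ∷_) (trans (map-++ f (b ∷ʳ x) [ M ]) (cong (_∷ʳ f M) (map-++ f b [ x ])))
  s≤M : s ≤ M
  s≤M = All.lookup (All.++⁺ (All.map <⇒≤ a<M) (≤-refl ∷ []))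
                   (spi-∈ (∈-++⁺ʳ (b ∷ʳ x) (here refl)))
  sbx<fM : All (_< f M) ((s ∷ map f b) ∷ʳ f x)
  sbx<fM = subst (s <_) (sym (shiftUp-≥ s≤M)) (s≤s s≤M)
    ∷ subst (All (_< f M)) (map-++ f b [ x ]) (All.map⁺ (All.map (shiftUp-strictMono s) a<M))

theorem6p3 : (n : ℕ) → 3 ≤ n →
    ((w : Word) → AndI (n ∸ 1) w → Tight n (φ w))
    × ((w w' : Word) → AndI (n ∸ 1) w → AndI (n ∸ 1) w' → φ w ≡ φ w' → w ≡ w')
    × ((u : Word) → Tight n u → Σ Word λ w → AndI (n ∸ 1) w × φ w ≡ u)
    × ((w : Word) → AndI (n ∸ 1) w →
         (spi w ≡ F (φ w))
         × (grn w < spi w → grn (φ w) ≡ grn w)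
         × (spi w < grn w → grn (φ w) ≡ suc (grn w)))
theorem6p3 (suc zero)          (s≤s ())
theorem6p3 (suc (suc zero))    (s≤s (s≤s ()))
theorem6p3 (suc (suc (suc k))) _ =
  (λ _ → φ-tight) ,
  (λ _ _ _ _ → φ-injective) ,
  (λ _ → φ-surjective) ,
  λ _ w∈ → refl ,
    (λ grn<spi → trans (grn-φ w∈) (shiftUp-< grn<spi)) ,
    (λ spi<grn → trans (grn-φ w∈) (shiftUp-≥ (<⇒≤ spi<grn)))
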